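{- Let $\mathbb{K}\in\{\mathbb{R},\mathbb{C}\}$, let $A_1,\ldots,A_k\in M_n(\mathbb{K})$ be simultaneously diagonalizable, and let $\alpha_2,\ldots,\alpha_k\in\mathbb{K}$ be such that every invertible matrix $T$ for which $T^{ -1}AT$ is diagonal, where $A=A_1+\alpha_2A_2+\cdots+\alpha_kA_k$, also makes $T^{ -1}A_iT$ diagonal for all $i=1,\ldots,k$. Then $Z(A)=\bigcap_{i=1}^kZ(A_i)$.
   Context: For a matrix $M$, $Z(M)$ denotes its centralizer, the subspace of matrices (in $M_n(\mathbb{K})$) that commute with $M$. -}

module Defs where

open import Level using (Level; _⊔_)
open import Data.Nat using (ℕ; zero; suc)
open import Data.Fin using (Fin; zero; suc)
open import Data.Product using (Σ; ∃; _×_)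
open import Relation.Nullary using (¬_)
open import Relation.Binary.PropositionalEquality using (_≡_)
open import Algebra.Bundles using (CommutativeRing)

IsField : ∀ {c ℓ} → CommutativeRing c ℓ → Set (c ⊔ ℓ)
IsField R = (¬ (1# ≈ 0#)) × (∀ x → ¬ (x ≈ 0#) → ∃ λ y → (x * y) ≈ 1#)
  where open CommutativeRing R

module Matrices {c ℓ} (R : CommutativeRing c ℓ) where
  open CommutativeRing R using (Carrier; _≈_; _+_; _*_; 0#; 1#)

  Mat : ℕ → Set c
  Mat n = Fin n → Fin n → Carrier

  sumF : ∀ {n} → (Fin n → Carrier) → Carrier
  sumF {zero}  f = 0#
  sumF {suc n} f = f zero + sumF (λ i → f (suc i))

  _≈ᴹ_ : ∀ {n} → Mat n → Mat n → Set ℓ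
  M ≈ᴹ N = ∀ i j → M i j ≈ N i j

  _+ᴹ_ : ∀ {n} → Mat n → Mat n → Mat n
  (M +ᴹ N) i j = M i j + N i j

  _•ᴹ_ : ∀ {n} → Carrier → Mat n → Mat n
  (a •ᴹ M) i j = a * M i j

  _·ᴹ_ : ∀ {n} → Mat n → Mat n → Mat n
  (M ·ᴹ N) i j = sumF (λ k → M i k * N k j)

  infixl 7 _·ᴹ_ _•ᴹ_
  infixl 6 _+ᴹ_
  infix 4 _≈ᴹ_

  Iᴹ : ∀ {n} → Mat n
  Iᴹ zero    zero    = 1#
  Iᴹ zero    (suc j) = 0#
  Iᴹ (suc i) zero    = 0#
  Iᴹ (suc i) (suc j) = Iᴹ i j

  sumᴹ : ∀ {n k} → (Fin k → Mat n) → Mat n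
  sumᴹ {k = zero}  f i j = 0#
  sumᴹ {k = suc k} f = f zero +ᴹ sumᴹ (λ t → f (suc t))

  IsDiagonal : ∀ {n} → Mat n → Set (ℓ)
  IsDiagonal M = ∀ i j → ¬ (i ≡ j) → M i j ≈ 0#

  IsInverse : ∀ {n} → Mat n → Mat n → Set ℓ
  IsInverse S T = (S ·ᴹ T ≈ᴹ Iᴹ) × (T ·ᴹ S ≈ᴹ Iᴹ)

  _∈Z_ : ∀ {n} → Mat n → Mat n → Set ℓ
  X ∈Z M = X ·ᴹ M ≈ᴹ M ·ᴹ X

  SimDiagonalizable : ∀ {n k} → (Fin k → Mat n) → Set (c ⊔ ℓ)
  SimDiagonalizable {n} A =
    Σ (Mat n) λ T → Σ (Mat n) λ S → IsInverse S T × (∀ i → IsDiagonal (S ·ᴹ A i ·ᴹ T))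

-- Conjugate by an invertible T diagonalising A and all the Aᵢ, so that Y = T⁻¹XT
-- commutes with the diagonal D = T⁻¹AT, i.e. Y_ab (D_aa - D_bb) = 0.  For a ≠ b put
-- c = Y_ab and let P = I + c E_ab be a shear.  Conjugating a diagonal matrix D′ by P
-- changes only its (a,b) entry, which becomes c (D′_aa - D′_bb).  Hence TP still
-- diagonalises A, so by hypothesis it diagonalises every Aᵢ, and reading off the
-- (a,b) entry gives Y_ab (Dᵢ_aa - Dᵢ_bb) = 0: Y commutes with each Dᵢ = T⁻¹AᵢT.
-- Only ring operations occur, so the argument works over any commutative ring.
module Submission where

open import Defs
open import Level using (_⊔_)
open import Data.Nat using (ℕ; zero; suc)
open import Data.Fin using (Fin; zero; suc)
open import Data.Fin.Properties using (suc-injective; _≟_)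
open import Data.Product using (_×_; _,_; proj₁; proj₂)
open import Data.Empty using (⊥-elim)
open import Relation.Nullary using (¬_; yes; no)
import Relation.Binary.PropositionalEquality as ≡
open ≡ using (_≡_)
open import Relation.Binary.Bundles using (Setoid)
import Relation.Binary.Reasoning.Setoid as SetoidReasoning
open import Algebra.Bundles using (CommutativeRing)
import Algebra.Properties.CommutativeSemigroup as CommutativeSemigroupProperties
import Algebra.Properties.Group as GroupProperties
import Algebra.Properties.Ring as RingProperties
open import Function.Bundles using (_⇔_; mk⇔; Equivalence)

module MatrixAlgebra {c ℓ} (K : CommutativeRing c ℓ) where

  open CommutativeRing K hiding (zero)
  open Matrices K
  open CommutativeSemigroupProperties +-commutativeSemigroup using (interchange)
  open CommutativeSemigroupProperties *-commutativeSemigroup using (x∙yz≈y∙xz; x∙yz≈z∙yx)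
  open GroupProperties +-group using (x∙y⁻¹≈ε⇒x≈y; x≈y⇒x∙y⁻¹≈ε)
  open RingProperties ring using (-‿distribˡ-*)

  private
    variable
      n k : ℕ

  sumF-cong : {f g : Fin n → Carrier} → (∀ i → f i ≈ g i) → sumF f ≈ sumF g
  sumF-cong {zero}  f≈g = refl
  sumF-cong {suc n} f≈g = +-cong (f≈g zero) (sumF-cong (λ i → f≈g (suc i)))

  sumF-zero : {f : Fin n → Carrier} → (∀ i → f i ≈ 0#) → sumF f ≈ 0#
  sumF-zero {zero}  f≈0 = refl
  sumF-zero {suc n} f≈0 = trans (+-cong (f≈0 zero) (sumF-zero (λ i → f≈0 (suc i)))) (+-identityˡ 0#)

  sumF-+ : (f g : Fin n → Carrier) → sumF (λ i → f i + g i) ≈ sumF f + sumF g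
  sumF-+ {zero}  f g = sym (+-identityˡ 0#)
  sumF-+ {suc n} f g =
    trans (+-cong refl (sumF-+ (λ i → f (suc i)) (λ i → g (suc i)))) (interchange _ _ _ _)

  sumF-*ˡ : ∀ a (f : Fin n → Carrier) → sumF (λ i → a * f i) ≈ a * sumF f
  sumF-*ˡ {zero}  a f = sym (zeroʳ a)
  sumF-*ˡ {suc n} a f = trans (+-cong refl (sumF-*ˡ a (λ i → f (suc i)))) (sym (distribˡ a _ _))

  sumF-*ʳ : ∀ a (f : Fin n → Carrier) → sumF (λ i → f i * a) ≈ sumF f * a
  sumF-*ʳ {zero}  a f = sym (zeroˡ a)
  sumF-*ʳ {suc n} a f = trans (+-cong refl (sumF-*ʳ a (λ i → f (suc i)))) (sym (distribʳ a _ _))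

  sumF-swap : (f : Fin n → Fin k → Carrier) →
              sumF (λ i → sumF (λ j → f i j)) ≈ sumF (λ j → sumF (λ i → f i j))
  sumF-swap {zero} {k} f = sym (sumF-zero {k} (λ j → refl))
  sumF-swap {suc n} f = trans (+-cong refl (sumF-swap (λ i → f (suc i))))
                              (sym (sumF-+ (f zero) (λ j → sumF (λ i → f (suc i) j))))

  sumF-single : {f : Fin n → Carrier} (j : Fin n) → (∀ i → ¬ i ≡ j → f i ≈ 0#) → sumF f ≈ f j
  sumF-single zero    f≈0 = trans (+-cong refl (sumF-zero (λ i → f≈0 (suc i) (λ ())))) (+-identityʳ _)
  sumF-single (suc j) f≈0 =
    trans (+-cong (f≈0 zero (λ ()))
                  (sumF-single j (λ i i≢j → f≈0 (suc i) (λ e → i≢j (suc-injective e)))))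
          (+-identityˡ _)

  Iᴹ-diagonal : (i : Fin n) → Iᴹ i i ≈ 1#
  Iᴹ-diagonal zero    = refl
  Iᴹ-diagonal (suc i) = Iᴹ-diagonal i

  Iᴹ-off-diagonal : (i j : Fin n) → ¬ i ≡ j → Iᴹ i j ≈ 0#
  Iᴹ-off-diagonal zero    zero    i≢j = ⊥-elim (i≢j ≡.refl)
  Iᴹ-off-diagonal zero    (suc j) i≢j = refl
  Iᴹ-off-diagonal (suc i) zero    i≢j = refl
  Iᴹ-off-diagonal (suc i) (suc j) i≢j = Iᴹ-off-diagonal i j (λ e → i≢j (≡.cong suc e))

  Iᴹ-*-shift : (f : Fin n → Carrier) (i j : Fin n) → Iᴹ i j * f j ≈ Iᴹ i j * f i
  Iᴹ-*-shift f i j with i ≟ j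
  ... | yes ≡.refl = refl
  ... | no  i≢j    = trans (*-cong (Iᴹ-off-diagonal i j i≢j) refl)
                           (trans (zeroˡ _) (sym (trans (*-cong (Iᴹ-off-diagonal i j i≢j) refl) (zeroˡ _))))

  ≈ᴹ-setoid : ℕ → Setoid c ℓ
  ≈ᴹ-setoid n = record
    { Carrier       = Mat n
    ; _≈_           = _≈ᴹ_
    ; isEquivalence = record
      { refl  = λ i j → refl
      ; sym   = λ M≈N i j → sym (M≈N i j)
      ; trans = λ M≈N N≈O i j → trans (M≈N i j) (N≈O i j)
      }
    }

  module ≈ᴹ {n} = Setoid (≈ᴹ-setoid n)
  module ≈ᴹ-Reasoning {n} = SetoidReasoning (≈ᴹ-setoid n)

  0ᴹ : Mat n
  0ᴹ i j = 0#

  +ᴹ-cong : {M M′ N N′ : Mat n} → M ≈ᴹ M′ → N ≈ᴹ N′ → M +ᴹ N ≈ᴹ M′ +ᴹ N′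
  +ᴹ-cong M≈M′ N≈N′ i j = +-cong (M≈M′ i j) (N≈N′ i j)

  •ᴹ-cong : ∀ a {M M′ : Mat n} → M ≈ᴹ M′ → a •ᴹ M ≈ᴹ a •ᴹ M′
  •ᴹ-cong a M≈M′ i j = *-cong refl (M≈M′ i j)

  ·ᴹ-cong : {M M′ N N′ : Mat n} → M ≈ᴹ M′ → N ≈ᴹ N′ → M ·ᴹ N ≈ᴹ M′ ·ᴹ N′
  ·ᴹ-cong M≈M′ N≈N′ i j = sumF-cong (λ k → *-cong (M≈M′ i k) (N≈N′ k j))

  ·ᴹ-assoc : (M N O : Mat n) → (M ·ᴹ N) ·ᴹ O ≈ᴹ M ·ᴹ (N ·ᴹ O)
  ·ᴹ-assoc {n} M N O i j = begin
    sumF (λ k → sumF (λ m → M i m * N m k) * O k j)   ≈⟨ sumF-cong {n} (λ k → sym (sumF-*ʳ {n} (O k j) _)) ⟩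
    sumF (λ k → sumF (λ m → M i m * N m k * O k j))   ≈⟨ sumF-swap {n} {n} _ ⟩
    sumF (λ m → sumF (λ k → M i m * N m k * O k j))   ≈⟨ sumF-cong {n} (λ m → sumF-cong {n} (λ k → *-assoc _ _ _)) ⟩
    sumF (λ m → sumF (λ k → M i m * (N m k * O k j))) ≈⟨ sumF-cong {n} (λ m → sumF-*ˡ {n} (M i m) _) ⟩
    sumF (λ m → M i m * sumF (λ k → N m k * O k j))   ∎
    where open SetoidReasoning setoid

  ·ᴹ-identityˡ : (M : Mat n) → Iᴹ ·ᴹ M ≈ᴹ M
  ·ᴹ-identityˡ M i j =
    trans (sumF-single i (λ k k≢i → trans (*-cong (Iᴹ-off-diagonal i k (λ e → k≢i (≡.sym e))) refl) (zeroˡ _)))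
          (trans (*-cong (Iᴹ-diagonal i) refl) (*-identityˡ _))

  ·ᴹ-identityʳ : (M : Mat n) → M ·ᴹ Iᴹ ≈ᴹ M
  ·ᴹ-identityʳ M i j =
    trans (sumF-single j (λ k k≢j → trans (*-cong refl (Iᴹ-off-diagonal k j k≢j)) (zeroʳ _)))
          (trans (*-cong refl (Iᴹ-diagonal j)) (*-identityʳ _))

  ·ᴹ-distribˡ : (M N O : Mat n) → M ·ᴹ (N +ᴹ O) ≈ᴹ M ·ᴹ N +ᴹ M ·ᴹ O
  ·ᴹ-distribˡ {n} M N O i j = trans (sumF-cong {n} (λ k → distribˡ (M i k) _ _)) (sumF-+ {n} _ _)

  ·ᴹ-distribʳ : (M N O : Mat n) → (M +ᴹ N) ·ᴹ O ≈ᴹ M ·ᴹ O +ᴹ N ·ᴹ O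
  ·ᴹ-distribʳ {n} M N O i j = trans (sumF-cong {n} (λ k → distribʳ (O k j) _ _)) (sumF-+ {n} _ _)

  ·ᴹ-zeroˡ : (M : Mat n) → 0ᴹ ·ᴹ M ≈ᴹ 0ᴹ
  ·ᴹ-zeroˡ {n} M i j = sumF-zero {n} (λ k → zeroˡ _)

  ·ᴹ-zeroʳ : (M : Mat n) → M ·ᴹ 0ᴹ ≈ᴹ 0ᴹ
  ·ᴹ-zeroʳ {n} M i j = sumF-zero {n} (λ k → zeroʳ _)

  ·ᴹ-•ᴹˡ : ∀ a (M N : Mat n) → (a •ᴹ M) ·ᴹ N ≈ᴹ a •ᴹ (M ·ᴹ N)
  ·ᴹ-•ᴹˡ {n} a M N i j = trans (sumF-cong {n} (λ k → *-assoc _ _ _)) (sumF-*ˡ {n} a _)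

  ·ᴹ-•ᴹʳ : ∀ a (M N : Mat n) → M ·ᴹ (a •ᴹ N) ≈ᴹ a •ᴹ (M ·ᴹ N)
  ·ᴹ-•ᴹʳ {n} a M N i j = trans (sumF-cong {n} (λ k → x∙yz≈y∙xz (M i k) a (N k j))) (sumF-*ˡ {n} a _)

  conjugate-cong : (S T : Mat n) {M N : Mat n} → M ≈ᴹ N → S ·ᴹ M ·ᴹ T ≈ᴹ S ·ᴹ N ·ᴹ T
  conjugate-cong S T M≈N = ·ᴹ-cong (·ᴹ-cong ≈ᴹ.refl M≈N) ≈ᴹ.refl

  conjugate-+ᴹ : (S T M N : Mat n) → S ·ᴹ (M +ᴹ N) ·ᴹ T ≈ᴹ S ·ᴹ M ·ᴹ T +ᴹ S ·ᴹ N ·ᴹ T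
  conjugate-+ᴹ S T M N = ≈ᴹ.trans (·ᴹ-cong (·ᴹ-distribˡ S M N) ≈ᴹ.refl) (·ᴹ-distribʳ _ _ T)

  conjugate-•ᴹ : ∀ a (S T M : Mat n) → S ·ᴹ (a •ᴹ M) ·ᴹ T ≈ᴹ a •ᴹ (S ·ᴹ M ·ᴹ T)
  conjugate-•ᴹ a S T M = ≈ᴹ.trans (·ᴹ-cong (·ᴹ-•ᴹʳ a S M) ≈ᴹ.refl) (·ᴹ-•ᴹˡ a _ T)

  conjugate-0ᴹ : (S T : Mat n) → S ·ᴹ 0ᴹ ·ᴹ T ≈ᴹ 0ᴹ
  conjugate-0ᴹ S T = ≈ᴹ.trans (·ᴹ-cong (·ᴹ-zeroʳ S) ≈ᴹ.refl) (·ᴹ-zeroˡ T)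

  conjugate-∘ : (S′ S M T T′ : Mat n) → (S′ ·ᴹ S) ·ᴹ M ·ᴹ (T ·ᴹ T′) ≈ᴹ S′ ·ᴹ (S ·ᴹ M ·ᴹ T) ·ᴹ T′
  conjugate-∘ S′ S M T T′ = begin
    (S′ ·ᴹ S) ·ᴹ M ·ᴹ (T ·ᴹ T′)   ≈⟨ ·ᴹ-assoc _ T T′ ⟨
    (S′ ·ᴹ S) ·ᴹ M ·ᴹ T ·ᴹ T′     ≈⟨ ·ᴹ-cong (·ᴹ-cong (·ᴹ-assoc S′ S M) ≈ᴹ.refl) ≈ᴹ.refl ⟩
    S′ ·ᴹ (S ·ᴹ M) ·ᴹ T ·ᴹ T′     ≈⟨ ·ᴹ-cong (·ᴹ-assoc S′ (S ·ᴹ M) T) ≈ᴹ.refl ⟩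
    S′ ·ᴹ (S ·ᴹ M ·ᴹ T) ·ᴹ T′     ∎
    where open ≈ᴹ-Reasoning

  cancel-inner : (W U V Z : Mat n) → U ·ᴹ V ≈ᴹ Iᴹ → (W ·ᴹ U) ·ᴹ (V ·ᴹ Z) ≈ᴹ W ·ᴹ Z
  cancel-inner W U V Z U·V≈I = begin
    (W ·ᴹ U) ·ᴹ (V ·ᴹ Z)   ≈⟨ ·ᴹ-assoc W U (V ·ᴹ Z) ⟩
    W ·ᴹ (U ·ᴹ (V ·ᴹ Z))   ≈⟨ ·ᴹ-cong ≈ᴹ.refl (·ᴹ-assoc U V Z) ⟨
    W ·ᴹ (U ·ᴹ V ·ᴹ Z)     ≈⟨ ·ᴹ-cong ≈ᴹ.refl (·ᴹ-cong U·V≈I ≈ᴹ.refl) ⟩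
    W ·ᴹ (Iᴹ ·ᴹ Z)         ≈⟨ ·ᴹ-cong ≈ᴹ.refl (·ᴹ-identityˡ Z) ⟩
    W ·ᴹ Z                 ∎
    where open ≈ᴹ-Reasoning

  conjugate-·ᴹ : (S T M N : Mat n) → T ·ᴹ S ≈ᴹ Iᴹ →
                 (S ·ᴹ M ·ᴹ T) ·ᴹ (S ·ᴹ N ·ᴹ T) ≈ᴹ S ·ᴹ (M ·ᴹ N) ·ᴹ T
  conjugate-·ᴹ S T M N T·S≈I = begin
    (S ·ᴹ M ·ᴹ T) ·ᴹ (S ·ᴹ N ·ᴹ T)   ≈⟨ ·ᴹ-cong ≈ᴹ.refl (·ᴹ-assoc S N T) ⟩
    (S ·ᴹ M ·ᴹ T) ·ᴹ (S ·ᴹ (N ·ᴹ T)) ≈⟨ cancel-inner (S ·ᴹ M) T S (N ·ᴹ T) T·S≈I ⟩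
    S ·ᴹ M ·ᴹ (N ·ᴹ T)               ≈⟨ ·ᴹ-assoc (S ·ᴹ M) N T ⟨
    S ·ᴹ M ·ᴹ N ·ᴹ T                 ≈⟨ ·ᴹ-cong (·ᴹ-assoc S M N) ≈ᴹ.refl ⟩
    S ·ᴹ (M ·ᴹ N) ·ᴹ T               ∎
    where open ≈ᴹ-Reasoning

  conjugate-inverse : (S T M : Mat n) → IsInverse S T → T ·ᴹ (S ·ᴹ M ·ᴹ T) ·ᴹ S ≈ᴹ M
  conjugate-inverse S T M (S·T≈I , T·S≈I) = begin
    T ·ᴹ (S ·ᴹ M ·ᴹ T) ·ᴹ S   ≈⟨ ·ᴹ-assoc T _ S ⟩
    T ·ᴹ (S ·ᴹ M ·ᴹ T ·ᴹ S)   ≈⟨ ·ᴹ-cong ≈ᴹ.refl (·ᴹ-assoc (S ·ᴹ M) T S) ⟩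
    T ·ᴹ (S ·ᴹ M ·ᴹ (T ·ᴹ S)) ≈⟨ ·ᴹ-cong ≈ᴹ.refl (·ᴹ-cong ≈ᴹ.refl T·S≈I) ⟩
    T ·ᴹ (S ·ᴹ M ·ᴹ Iᴹ)       ≈⟨ ·ᴹ-cong ≈ᴹ.refl (·ᴹ-identityʳ (S ·ᴹ M)) ⟩
    T ·ᴹ (S ·ᴹ M)             ≈⟨ ·ᴹ-assoc T S M ⟨
    T ·ᴹ S ·ᴹ M               ≈⟨ ·ᴹ-cong T·S≈I ≈ᴹ.refl ⟩
    Iᴹ ·ᴹ M                   ≈⟨ ·ᴹ-identityˡ M ⟩
    M                         ∎
    where open ≈ᴹ-Reasoning

  IsInverse-·ᴹ : {S T S′ T′ : Mat n} → IsInverse S T → IsInverse S′ T′ →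
                 IsInverse (S′ ·ᴹ S) (T ·ᴹ T′)
  IsInverse-·ᴹ {S = S} {T} {S′} {T′} (S·T≈I , T·S≈I) (S′·T′≈I , T′·S′≈I) =
    ≈ᴹ.trans (cancel-inner S′ S T T′ S·T≈I) S′·T′≈I ,
    ≈ᴹ.trans (cancel-inner T T′ S′ S T′·S′≈I) T·S≈I

  record IsSubspace {p} (P : Mat n → Set p) : Set (c ⊔ p) where
    field
      0ᴹ-closed : P 0ᴹ
      +ᴹ-closed : {M N : Mat n} → P M → P N → P (M +ᴹ N)
      •ᴹ-closed : ∀ a {M : Mat n} → P M → P (a •ᴹ M)

    sumᴹ-closed : (F : Fin k → Mat n) → (∀ j → P (F j)) → P (sumᴹ F)
    sumᴹ-closed {zero}  F F∈P = 0ᴹ-closed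
    sumᴹ-closed {suc k} F F∈P = +ᴹ-closed (F∈P zero) (sumᴹ-closed (λ j → F (suc j)) (λ j → F∈P (suc j)))

    combination-closed : (B : Fin (suc k) → Mat n) (α : Fin k → Carrier) → (∀ i → P (B i)) →
                         P (B zero +ᴹ sumᴹ (λ j → α j •ᴹ B (suc j)))
    combination-closed B α B∈P =
      +ᴹ-closed (B∈P zero) (sumᴹ-closed _ (λ j → •ᴹ-closed (α j) (B∈P (suc j))))

  ∈Z-resp : {X X′ M M′ : Mat n} → X ≈ᴹ X′ → M ≈ᴹ M′ → X ∈Z M → X′ ∈Z M′
  ∈Z-resp X≈X′ M≈M′ X∈ZM =
    ≈ᴹ.trans (·ᴹ-cong (≈ᴹ.sym X≈X′) (≈ᴹ.sym M≈M′)) (≈ᴹ.trans X∈ZM (·ᴹ-cong M≈M′ X≈X′))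

  centralizer-isSubspace : (X : Mat n) → IsSubspace (X ∈Z_)
  centralizer-isSubspace X = record
    { 0ᴹ-closed = ≈ᴹ.trans (·ᴹ-zeroʳ X) (≈ᴹ.sym (·ᴹ-zeroˡ X))
    ; +ᴹ-closed = λ {M} {N} X∈ZM X∈ZN →
        ≈ᴹ.trans (·ᴹ-distribˡ X M N) (≈ᴹ.trans (+ᴹ-cong X∈ZM X∈ZN) (≈ᴹ.sym (·ᴹ-distribʳ M N X)))
    ; •ᴹ-closed = λ a {M} X∈ZM →
        ≈ᴹ.trans (·ᴹ-•ᴹʳ a X M) (≈ᴹ.trans (•ᴹ-cong a X∈ZM) (≈ᴹ.sym (·ᴹ-•ᴹˡ a M X)))
    }

  ∈Z-conjugate : (S T : Mat n) {X M : Mat n} → T ·ᴹ S ≈ᴹ Iᴹ →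
                 X ∈Z M → (S ·ᴹ X ·ᴹ T) ∈Z (S ·ᴹ M ·ᴹ T)
  ∈Z-conjugate S T {X} {M} T·S≈I X∈ZM = begin
    (S ·ᴹ X ·ᴹ T) ·ᴹ (S ·ᴹ M ·ᴹ T)   ≈⟨ conjugate-·ᴹ S T X M T·S≈I ⟩
    S ·ᴹ (X ·ᴹ M) ·ᴹ T               ≈⟨ conjugate-cong S T X∈ZM ⟩
    S ·ᴹ (M ·ᴹ X) ·ᴹ T               ≈⟨ conjugate-·ᴹ S T M X T·S≈I ⟨
    (S ·ᴹ M ·ᴹ T) ·ᴹ (S ·ᴹ X ·ᴹ T)   ∎
    where open ≈ᴹ-Reasoning

  ∈Z-conjugate⇔ : (S T : Mat n) {X M : Mat n} → IsInverse S T →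
                  X ∈Z M ⇔ (S ·ᴹ X ·ᴹ T) ∈Z (S ·ᴹ M ·ᴹ T)
  ∈Z-conjugate⇔ S T {X} {M} S⁻¹ = mk⇔ (∈Z-conjugate S T (proj₂ S⁻¹))
    (λ conj∈Z → ∈Z-resp (conjugate-inverse S T X S⁻¹) (conjugate-inverse S T M S⁻¹)
                        (∈Z-conjugate T S (proj₁ S⁻¹) conj∈Z))

  IsDiagonal-resp : {M N : Mat n} → M ≈ᴹ N → IsDiagonal M → IsDiagonal N
  IsDiagonal-resp M≈N M-diag i j i≢j = trans (sym (M≈N i j)) (M-diag i j i≢j)

  conjugate-diagonal-isSubspace : (S T : Mat n) → IsSubspace (λ M → IsDiagonal (S ·ᴹ M ·ᴹ T))
  conjugate-diagonal-isSubspace S T = record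
    { 0ᴹ-closed = IsDiagonal-resp (≈ᴹ.sym (conjugate-0ᴹ S T)) (λ i j i≢j → refl)
    ; +ᴹ-closed = λ {M} {N} M-diag N-diag →
        IsDiagonal-resp (≈ᴹ.sym (conjugate-+ᴹ S T M N))
          (λ i j i≢j → trans (+-cong (M-diag i j i≢j) (N-diag i j i≢j)) (+-identityˡ 0#))
    ; •ᴹ-closed = λ a {M} M-diag →
        IsDiagonal-resp (≈ᴹ.sym (conjugate-•ᴹ a S T M))
          (λ i j i≢j → trans (*-cong refl (M-diag i j i≢j)) (zeroʳ a))
    }

  ·ᴹ-diagonalʳ : (M : Mat n) {D : Mat n} → IsDiagonal D → ∀ i j → (M ·ᴹ D) i j ≈ M i j * D j j
  ·ᴹ-diagonalʳ M D-diag i j = sumF-single j (λ k k≢j → trans (*-cong refl (D-diag k j k≢j)) (zeroʳ _))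

  ·ᴹ-diagonalˡ : (M : Mat n) {D : Mat n} → IsDiagonal D → ∀ i j → (D ·ᴹ M) i j ≈ D i i * M i j
  ·ᴹ-diagonalˡ M D-diag i j =
    sumF-single i (λ k k≢i → trans (*-cong (D-diag i k (λ e → k≢i (≡.sym e))) refl) (zeroˡ _))

  ∈Z-diagonal⇔ : {D : Mat n} → IsDiagonal D → (Y : Mat n) →
                 Y ∈Z D ⇔ (∀ i j → Y i j * D i i ≈ Y i j * D j j)
  ∈Z-diagonal⇔ {D = D} D-diag Y = mk⇔
    (λ Y∈ZD i j → sym (begin
      Y i j * D j j   ≈⟨ ·ᴹ-diagonalʳ Y D-diag i j ⟨
      (Y ·ᴹ D) i j    ≈⟨ Y∈ZD i j ⟩
      (D ·ᴹ Y) i j    ≈⟨ ·ᴹ-diagonalˡ Y D-diag i j ⟩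
      D i i * Y i j   ≈⟨ *-comm _ _ ⟩
      Y i j * D i i   ∎))
    (λ entries i j → begin
      (Y ·ᴹ D) i j    ≈⟨ ·ᴹ-diagonalʳ Y D-diag i j ⟩
      Y i j * D j j   ≈⟨ entries i j ⟨
      Y i j * D i i   ≈⟨ *-comm _ _ ⟩
      D i i * Y i j   ≈⟨ ·ᴹ-diagonalˡ Y D-diag i j ⟨
      (D ·ᴹ Y) i j    ∎)
    where open SetoidReasoning setoid

  -- Shears I + x E_kl

  difference≈0⇔ : ∀ x p q → (x * p + - x * q ≈ 0#) ⇔ (x * p ≈ x * q)
  difference≈0⇔ x p q = mk⇔
    (λ d≈0 → x∙y⁻¹≈ε⇒x≈y _ _ (trans (+-cong refl (-‿distribˡ-* x q)) d≈0))
    (λ xp≈xq → trans (+-cong refl (sym (-‿distribˡ-* x q))) (x≈y⇒x∙y⁻¹≈ε xp≈xq))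

  shear-entry-rearrange : ∀ u v x y d e → u * (y * (v * d)) + u * e * (x * v) ≈ u * v * (x * e + y * d)
  shear-entry-rearrange u v x y d e = begin
    u * (y * (v * d)) + u * e * (x * v)   ≈⟨ +-cong (*-cong refl (x∙yz≈y∙xz y v d))
                                                   (trans (*-assoc u e _) (*-cong refl (x∙yz≈z∙yx e x v))) ⟩
    u * (v * (y * d)) + u * (v * (x * e)) ≈⟨ +-cong (*-assoc u v _) (*-assoc u v _) ⟨
    u * v * (y * d) + u * v * (x * e)     ≈⟨ distribˡ (u * v) _ _ ⟨
    u * v * (y * d + x * e)               ≈⟨ *-cong refl (+-comm _ _) ⟩
    u * v * (x * e + y * d)               ∎
    where open SetoidReasoning setoid

  module Shear (k l : Fin n) (k≢l : ¬ k ≡ l) where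

    E : Carrier → Mat n
    E x i j = Iᴹ i k * (x * Iᴹ l j)

    P : Carrier → Mat n
    P x = Iᴹ +ᴹ E x

    Iᴹ-lk : Iᴹ l k ≈ 0#
    Iᴹ-lk = Iᴹ-off-diagonal l k (λ e → k≢l (≡.sym e))

    ·ᴹ-E : (M : Mat n) (x : Carrier) → ∀ i j → (M ·ᴹ E x) i j ≈ M i k * (x * Iᴹ l j)
    ·ᴹ-E M x i j =
      trans (sumF-single k (λ m m≢k → trans (*-cong refl (trans (*-cong (Iᴹ-off-diagonal m k m≢k) refl) (zeroˡ _)))
                                            (zeroʳ _)))
            (*-cong refl (trans (*-cong (Iᴹ-diagonal k) refl) (*-identityˡ _)))

    P-column-k : ∀ x i → P x i k ≈ Iᴹ i k
    P-column-k x i = trans (+-cong refl (trans (*-cong refl (trans (*-cong refl Iᴹ-lk) (zeroʳ x))) (zeroʳ _)))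
                           (+-identityʳ _)

    ·ᴹ-P : (M : Mat n) (x : Carrier) → ∀ i j → (M ·ᴹ P x) i j ≈ M i j + M i k * (x * Iᴹ l j)
    ·ᴹ-P M x i j = trans (·ᴹ-distribˡ M Iᴹ (E x) i j) (+-cong (·ᴹ-identityʳ M i j) (·ᴹ-E M x i j))

    P-inverse : ∀ x → IsInverse (P (- x)) (P x)
    P-inverse x = P-cancel (- x) x (-‿inverseˡ x) , P-cancel x (- x) (-‿inverseʳ x)
      where
      open SetoidReasoning setoid
      P-cancel : ∀ y z → y + z ≈ 0# → P y ·ᴹ P z ≈ᴹ Iᴹ
      P-cancel y z y+z≈0 i j = begin
        (P y ·ᴹ P z) i j                                   ≈⟨ ·ᴹ-P (P y) z i j ⟩
        P y i j + P y i k * (z * Iᴹ l j)                   ≈⟨ +-cong refl (*-cong (P-column-k y i) refl) ⟩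
        (Iᴹ i j + Iᴹ i k * (y * Iᴹ l j)) + Iᴹ i k * (z * Iᴹ l j)
                                                           ≈⟨ +-assoc _ _ _ ⟩
        Iᴹ i j + (Iᴹ i k * (y * Iᴹ l j) + Iᴹ i k * (z * Iᴹ l j))
                                                           ≈⟨ +-cong refl (distribˡ _ _ _) ⟨
        Iᴹ i j + Iᴹ i k * (y * Iᴹ l j + z * Iᴹ l j)        ≈⟨ +-cong refl (*-cong refl (distribʳ _ y z)) ⟨
        Iᴹ i j + Iᴹ i k * ((y + z) * Iᴹ l j)               ≈⟨ +-cong refl (*-cong refl (*-cong y+z≈0 refl)) ⟩
        Iᴹ i j + Iᴹ i k * (0# * Iᴹ l j)                    ≈⟨ +-cong refl (trans (*-cong refl (zeroˡ _)) (zeroʳ _)) ⟩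
        Iᴹ i j + 0#                                        ≈⟨ +-identityʳ _ ⟩
        Iᴹ i j                                             ∎

    shear-conjugate-entry : {D : Mat n} → IsDiagonal D → ∀ x y i j → ¬ i ≡ j →
      (P y ·ᴹ D ·ᴹ P x) i j ≈ Iᴹ i k * Iᴹ l j * (x * D k k + y * D l l)
    shear-conjugate-entry {D} D-diag x y i j i≢j = begin
      (P y ·ᴹ D ·ᴹ P x) i j                                        ≈⟨ ·ᴹ-P (P y ·ᴹ D) x i j ⟩
      (P y ·ᴹ D) i j + (P y ·ᴹ D) i k * (x * Iᴹ l j)               ≈⟨ +-cong (·ᴹ-diagonalʳ (P y) D-diag i j)
                                                                        (*-cong (·ᴹ-diagonalʳ (P y) D-diag i k) refl) ⟩
      P y i j * D j j + P y i k * D k k * (x * Iᴹ l j)             ≈⟨ +-cong (*-cong P-off-diagonal refl)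
                                                                        (*-cong (*-cong (P-column-k y i) refl) refl) ⟩
      Iᴹ i k * (y * Iᴹ l j) * D j j + Iᴹ i k * D k k * (x * Iᴹ l j) ≈⟨ +-cong Iᴹ-shift refl ⟩
      Iᴹ i k * (y * (Iᴹ l j * D l l)) + Iᴹ i k * D k k * (x * Iᴹ l j)
                                                                   ≈⟨ shear-entry-rearrange _ _ _ _ _ _ ⟩
      Iᴹ i k * Iᴹ l j * (x * D k k + y * D l l)                     ∎
      where
      open SetoidReasoning setoid
      P-off-diagonal : P y i j ≈ Iᴹ i k * (y * Iᴹ l j)
      P-off-diagonal = trans (+-cong (Iᴹ-off-diagonal i j i≢j) refl) (+-identityˡ _)
      Iᴹ-shift : Iᴹ i k * (y * Iᴹ l j) * D j j ≈ Iᴹ i k * (y * (Iᴹ l j * D l l))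
      Iᴹ-shift = trans (*-assoc _ _ _) (*-cong refl (trans (*-assoc _ _ _)
                   (*-cong refl (Iᴹ-*-shift (λ m → D m m) l j))))

    shear-conjugate-diagonal⇔ : {D : Mat n} → IsDiagonal D → ∀ x →
      IsDiagonal (P (- x) ·ᴹ D ·ᴹ P x) ⇔ (x * D k k ≈ x * D l l)
    shear-conjugate-diagonal⇔ {D} D-diag x = mk⇔
      (λ conj-diag → Equivalence.to (difference≈0⇔ x (D k k) (D l l)) (begin
        x * D k k + - x * D l l                              ≈⟨ *-identityˡ _ ⟨
        1# * (x * D k k + - x * D l l)                       ≈⟨ *-cong (*-identityˡ 1#) refl ⟨
        1# * 1# * (x * D k k + - x * D l l)                  ≈⟨ *-cong (*-cong (Iᴹ-diagonal k) (Iᴹ-diagonal l)) refl ⟨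
        Iᴹ k k * Iᴹ l l * (x * D k k + - x * D l l)          ≈⟨ shear-conjugate-entry D-diag x (- x) k l k≢l ⟨
        (P (- x) ·ᴹ D ·ᴹ P x) k l                            ≈⟨ conj-diag k l k≢l ⟩
        0#                                                   ∎))
      (λ xDkk≈xDll i j i≢j → begin
        (P (- x) ·ᴹ D ·ᴹ P x) i j                            ≈⟨ shear-conjugate-entry D-diag x (- x) i j i≢j ⟩
        Iᴹ i k * Iᴹ l j * (x * D k k + - x * D l l)          ≈⟨ *-cong refl (Equivalence.from (difference≈0⇔ x _ _) xDkk≈xDll) ⟩
        Iᴹ i k * Iᴹ l j * 0#                                 ≈⟨ zeroʳ _ ⟩
        0#                                                   ∎)
      where open SetoidReasoning setoid

  Diagonalises : (T S M : Mat n) → Set ℓ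
  Diagonalises T S M = IsInverse S T × IsDiagonal (S ·ᴹ M ·ᴹ T)

  diagonalisers⊆⇒centralizer⊆ : (T S : Mat n) {M N : Mat n} → Diagonalises T S M →
    (∀ T′ S′ → Diagonalises T′ S′ M → IsDiagonal (S′ ·ᴹ N ·ᴹ T′)) →
    ∀ X → X ∈Z M → X ∈Z N
  diagonalisers⊆⇒centralizer⊆ {n} T S {M} {N} (S⁻¹ , DM-diag) diagonalises X X∈ZM =
    Equivalence.from (∈Z-conjugate⇔ S T S⁻¹) (Equivalence.from (∈Z-diagonal⇔ DN-diag Y) Y-DN-entries)
    where
    Y DM DN : Mat n
    Y  = S ·ᴹ X ·ᴹ T
    DM = S ·ᴹ M ·ᴹ T
    DN = S ·ᴹ N ·ᴹ T

    DN-diag : IsDiagonal DN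
    DN-diag = diagonalises T S (S⁻¹ , DM-diag)

    Y-DM-entries : ∀ a b → Y a b * DM a a ≈ Y a b * DM b b
    Y-DM-entries = Equivalence.to (∈Z-diagonal⇔ DM-diag Y) (Equivalence.to (∈Z-conjugate⇔ S T S⁻¹) X∈ZM)

    Y-DN-entries : ∀ a b → Y a b * DN a a ≈ Y a b * DN b b
    Y-DN-entries a b with a ≟ b
    ... | yes ≡.refl = refl
    ... | no  a≢b    = Equivalence.to (shear-conjugate-diagonal⇔ DN-diag (Y a b)) sheared-DN-diag
      where
      open Shear a b a≢b
      S′ T′ : Mat n
      S′ = P (- Y a b) ·ᴹ S
      T′ = T ·ᴹ P (Y a b)

      sheared-M-diag : Diagonalises T′ S′ M
      sheared-M-diag =
        IsInverse-·ᴹ S⁻¹ (P-inverse (Y a b)) ,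
        IsDiagonal-resp (≈ᴹ.sym (conjugate-∘ (P (- Y a b)) S M T (P (Y a b))))
          (Equivalence.from (shear-conjugate-diagonal⇔ DM-diag (Y a b)) (Y-DM-entries a b))

      sheared-DN-diag : IsDiagonal (P (- Y a b) ·ᴹ DN ·ᴹ P (Y a b))
      sheared-DN-diag = IsDiagonal-resp (conjugate-∘ (P (- Y a b)) S N T (P (Y a b)))
                                        (diagonalises T′ S′ sheared-M-diag)

proposition2p10 : ∀ {c ℓ} (K : CommutativeRing c ℓ) → IsField K →
    let open Matrices K in
    (n m : ℕ) (A : Fin (suc m) → Mat n) (α : Fin m → CommutativeRing.Carrier K) →
    SimDiagonalizable A →
    (∀ (T S : Mat n) → IsInverse S T →
       IsDiagonal (S ·ᴹ (A zero +ᴹ sumᴹ (λ j → α j •ᴹ A (suc j))) ·ᴹ T) →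
       ∀ i → IsDiagonal (S ·ᴹ A i ·ᴹ T)) →
    ∀ (X : Mat n) →
      (X ∈Z (A zero +ᴹ sumᴹ (λ j → α j •ᴹ A (suc j)))) ⇔ (∀ i → X ∈Z A i)
proposition2p10 K _ n m A α (T , S , S⁻¹ , Aᵢ-diag) diagonalisers⊆ X = mk⇔
  (λ X∈ZA i → diagonalisers⊆⇒centralizer⊆ T S (S⁻¹ , A-diag)
                (λ T′ S′ (S′⁻¹ , D′) → diagonalisers⊆ T′ S′ S′⁻¹ D′ i) X X∈ZA)
  (λ X∈ZAᵢ → combination-closed (centralizer-isSubspace X) A α X∈ZAᵢ)
  where
  open Matrices K
  open MatrixAlgebra K
  open IsSubspace using (combination-closed)
  A-diag : IsDiagonal (S ·ᴹ (A zero +ᴹ sumᴹ (λ j → α j •ᴹ A (suc j))) ·ᴹ T)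
  A-diag = combination-closed (conjugate-diagonal-isSubspace S T) A α Aᵢ-diag
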